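{- For all nonnegative integers $n$ and $\Delta$ with $n \geq 2\Delta$, \[ F(n,\lfloor n/2\rfloor,\Delta) \geq 2^{ -2\Delta}\binom{n}{\lfloor n/2\rfloor}. \]
   Context: For a finite graph $G$, a permutation of the vertices of $G$ is a sequence listing every vertex of $G$ exactly once; two such permutations $\pi,\sigma$ are $G$-different if there is an index $i$ such that $\{\pi(i),\sigma(i)\}$ is an edge of $G$; $F(G)$ denotes the maximum size of a family of pairwise $G$-different permutations of the vertices of $G$. For a subgraph $G$ of $K_{a,n-a}$ on the same $n$ vertices (with the same bipartition), the bipartite complement of $G$ is the graph on the same vertices whose edges are the edges of $K_{a,n-a}$ not in $G$. $F(n,a,\Delta)$ denotes the minimum of $F(G)$ over all $n$-vertex bipartite graphs $G$ that are subgraphs of $K_{a,n-a}$ and whose bipartite complement has maximum degree $\Delta$. -}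

module Defs where

open import Data.Nat using (ℕ; zero; suc; _+_; _⊔_)
open import Data.Bool using (Bool; true; false; not; if_then_else_)
open import Data.Fin using (Fin; zero; suc)
open import Data.Sum using (_⊎_; inj₁; inj₂)
open import Data.Product using (∃; _×_; _,_)
open import Data.Empty using (⊥)
open import Relation.Binary.PropositionalEquality using (_≡_; _≢_)
open import Function.Bundles using (_↔_; Inverse)

-- A subgraph of K_{a,b}: vertex set Fin a ⊎ Fin b (the two sides of the
-- bipartition), edges given by a Boolean adjacency between the two sides.
BipGraph : ℕ → ℕ → Set
BipGraph a b = Fin a → Fin b → Bool

bipComplement : ∀ {a b} → BipGraph a b → BipGraph a b
bipComplement G x y = not (G x y)

Vertex : ℕ → ℕ → Set
Vertex a b = Fin a ⊎ Fin b

Adj : ∀ {a b} → BipGraph a b → Vertex a b → Vertex a b → Set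
Adj G (inj₁ x) (inj₂ y) = G x y ≡ true
Adj G (inj₂ y) (inj₁ x) = G x y ≡ true
Adj G (inj₁ _) (inj₁ _) = ⊥
Adj G (inj₂ _) (inj₂ _) = ⊥

countTrue : ∀ {m} → (Fin m → Bool) → ℕ
countTrue {zero} f = 0
countTrue {suc m} f = (if f zero then 1 else 0) + countTrue (λ k → f (suc k))

maxFin : ∀ {m} → (Fin m → ℕ) → ℕ
maxFin {zero} f = 0
maxFin {suc m} f = f zero ⊔ maxFin (λ k → f (suc k))

degree : ∀ {a b} → BipGraph a b → Vertex a b → ℕ
degree G (inj₁ x) = countTrue (λ y → G x y)
degree G (inj₂ y) = countTrue (λ x → G x y)

maxDegree : ∀ {a b} → BipGraph a b → ℕ
maxDegree {a} {b} G = maxFin (λ x → degree G (inj₁ x)) ⊔ maxFin (λ y → degree G (inj₂ y))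

-- a permutation of the n vertices: a sequence (indexed by positions Fin n)
-- listing every vertex exactly once
Perm : (n a b : ℕ) → Set
Perm n a b = Fin n ↔ Vertex a b

GDifferent : ∀ {n a b} → BipGraph a b → Perm n a b → Perm n a b → Set
GDifferent G π σ = ∃ λ i → Adj G (Inverse.to π i) (Inverse.to σ i)

PairwiseGDifferent : ∀ {n a b m} → BipGraph a b → (Fin m → Perm n a b) → Set
PairwiseGDifferent {m = m} G fam = (i j : Fin m) → i ≢ j → GDifferent G (fam i) (fam j)

-- F(G) ≥ k  (F(G) is the maximum size of such a family)
FAtLeast : ∀ {n a b} → BipGraph a b → ℕ → Set
FAtLeast {n} {a} {b} G k = ∃ λ (fam : Fin k → Perm n a b) → PairwiseGDifferent G fam

module Submission where

-- For G ⊆ K_{a,b} in which every first-side vertex misses at most Δ second-side vertices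
-- (e.g. when the bipartite complement has maximum degree Δ), we show F(G) ≥ C(r + s, r)
-- whenever r ≤ a and s + Δ ≤ b (`lower-bound`). The families are built recursively: a
-- permutation either begins with the first-side vertex 0, or with a fixed neighbour y of 0,
-- which exists because 0 misses at most Δ < b vertices. Prefixing pairwise different families
-- for G − {0} and for G − {y} by 0 and by y respectively gives two families that differ from
-- each other at position 0 (through the edge {0, y}), so their sizes add up via Pascal's rule.
--
-- Corollary 2 takes q = ⌊n/2⌋, b = n − q, r = q − Δ, s = b − Δ.

open import Defs
open import Data.Nat using (ℕ; zero; suc; _+_; _*_; _∸_; _^_; _≤_; _<_; z≤n; s≤s; _/_; _%_)
open import Data.Nat.Properties hiding (_≟_)
open import Data.Nat.DivMod using (m%n<n; m≡m%n+[m/n]*n; m/n≤m; m*n/n≡m; /-monoˡ-≤)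
open import Data.Nat.Combinatorics using (_C_; nCk+nC[k+1]≡[n+1]C[k+1]; nCk≡nC[n∸k]; nCn≡1; nC1≡n; k>n⇒nCk≡0)
open import Data.Nat.Tactic.RingSolver using (solve-∀)
open import Data.Fin using (Fin; zero; suc; punchIn; punchOut; splitAt; join)
open import Data.Fin.Properties using (+↔⊎; punchInᵢ≢i; punchIn-punchOut; punchOut-punchIn; _≟_)
open import Data.Bool using (Bool; true; false; not; if_then_else_)
open import Data.Sum using (_⊎_; inj₁; inj₂; [_,_])
import Data.Sum.Base as Sum using (map)
open import Data.Sum.Function.Propositional using (_⊎-↔_)
open import Data.Product using (∃; _×_; _,_; proj₁; proj₂)
open import Data.Empty using (⊥-elim)
open import Relation.Nullary using (yes; no)
open import Relation.Binary.PropositionalEquality hiding ([_])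
open import Function using (id)
open import Function.Bundles using (_↔_; Inverse; mk↔ₛ′)
open import Function.Construct.Composition using (_↔-∘_)
open import Function.Properties.Inverse using (↔-refl)

pascal : ∀ n k → suc n C suc k ≡ n C k + n C suc k
pascal n k = sym (nCk+nC[k+1]≡[n+1]C[k+1] n k)

nC0≡1 : ∀ n → n C 0 ≡ 1
nC0≡1 n = trans (nCk≡nC[n∸k] {0} {n} z≤n) (nCn≡1 n)

absorption : ∀ n k → suc k * (suc n C suc k) ≡ suc n * (n C k)
absorption n zero = begin
    1 * (suc n C 1)   ≡⟨ *-identityˡ _ ⟩
    suc n C 1         ≡⟨ nC1≡n (suc n) ⟩
    suc n             ≡⟨ *-identityʳ (suc n) ⟨
    suc n * 1         ≡⟨ cong (suc n *_) (nC0≡1 n) ⟨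
    suc n * (n C 0)   ∎
  where open ≡-Reasoning
absorption zero (suc k) = begin
    suc (suc k) * (1 C suc (suc k))  ≡⟨ cong (suc (suc k) *_) (k>n⇒nCk≡0 {1} {suc (suc k)} (s≤s (s≤s z≤n))) ⟩
    suc (suc k) * 0                  ≡⟨ *-zeroʳ (suc (suc k)) ⟩
    0                                ≡⟨ cong (1 *_) (k>n⇒nCk≡0 {0} {suc k} (s≤s z≤n)) ⟨
    1 * (0 C suc k)                  ∎
  where open ≡-Reasoning
absorption (suc n) (suc k) = begin
    suc (suc k) * (suc (suc n) C suc (suc k))
  ≡⟨ cong (suc (suc k) *_) (pascal (suc n) (suc k)) ⟩
    suc (suc k) * (suc n C suc k + suc n C suc (suc k))
  ≡⟨ split-factor (suc k) (suc n C suc k) (suc n C suc (suc k)) ⟩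
    suc k * (suc n C suc k) + suc n C suc k + suc (suc k) * (suc n C suc (suc k))
  ≡⟨ cong₂ (λ u v → u + suc n C suc k + v) (absorption n k) (absorption n (suc k)) ⟩
    suc n * (n C k) + suc n C suc k + suc n * (n C suc k)
  ≡⟨ cong (λ u → suc n * (n C k) + u + suc n * (n C suc k)) (pascal n k) ⟩
    suc n * (n C k) + (n C k + n C suc k) + suc n * (n C suc k)
  ≡⟨ merge-factor (suc n) (n C k) (n C suc k) ⟩
    suc (suc n) * (n C k + n C suc k)
  ≡⟨ cong (suc (suc n) *_) (pascal n k) ⟨
    suc (suc n) * (suc n C suc k)
  ∎
  where
  open ≡-Reasoning
  split-factor : ∀ a x y → suc a * (x + y) ≡ a * x + x + suc a * y
  split-factor = solve-∀
  merge-factor : ∀ a x y → a * x + (x + y) + a * y ≡ suc a * (x + y)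
  merge-factor = solve-∀

binomial-sym : ∀ k j → (k + j) C k ≡ (k + j) C j
binomial-sym k j = trans (nCk≡nC[n∸k] (m≤m+n k j)) (cong ((k + j) C_) (m+n∸m≡n k j))

absorption-complement : ∀ k j → suc j * (suc (k + j) C k) ≡ suc (k + j) * ((k + j) C k)
absorption-complement k j = begin
    suc j * (suc (k + j) C k)      ≡⟨ cong (λ m → suc j * (m C k)) (+-suc k j) ⟨
    suc j * ((k + suc j) C k)      ≡⟨ cong (suc j *_) (binomial-sym k (suc j)) ⟩
    suc j * ((k + suc j) C suc j)  ≡⟨ cong (λ m → suc j * (m C suc j)) (+-suc k j) ⟩
    suc j * (suc (k + j) C suc j)  ≡⟨ absorption (k + j) j ⟩
    suc (k + j) * ((k + j) C j)    ≡⟨ cong (suc (k + j) *_) (binomial-sym k j) ⟨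
    suc (k + j) * ((k + j) C k)    ∎
  where open ≡-Reasoning

double-absorption : ∀ k j → (suc k * suc j) * (suc (suc (k + j)) C suc k)
                            ≡ (suc (suc (k + j)) * suc (k + j)) * ((k + j) C k)
double-absorption k j = begin
    (suc k * suc j) * (N+2 C suc k)       ≡⟨ reassoc (suc k) (suc j) (N+2 C suc k) ⟩
    suc j * (suc k * (N+2 C suc k))       ≡⟨ cong (suc j *_) (absorption (suc (k + j)) k) ⟩
    suc j * (N+2 * (suc (k + j) C k))     ≡⟨ reassoc′ (suc j) N+2 (suc (k + j) C k) ⟩
    N+2 * (suc j * (suc (k + j) C k))     ≡⟨ cong (N+2 *_) (absorption-complement k j) ⟩
    N+2 * (suc (k + j) * ((k + j) C k))   ≡⟨ *-assoc N+2 (suc (k + j)) ((k + j) C k) ⟨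
    (N+2 * suc (k + j)) * ((k + j) C k)   ∎
  where
  open ≡-Reasoning
  N+2 = suc (suc (k + j))
  reassoc : ∀ a b x → (a * b) * x ≡ b * (a * x)
  reassoc = solve-∀
  reassoc′ : ∀ a b x → a * (b * x) ≡ b * (a * x)
  reassoc′ = solve-∀

-- A pair (k, j) is balanced when j ∈ {k, k + 1}: then C(k + j, k) is a central binomial coefficient.
Balanced : ℕ → ℕ → Set
Balanced k j = j ≡ k ⊎ j ≡ suc k

balanced-+ : ∀ {k j} d → Balanced k j → Balanced (k + d) (j + d)
balanced-+ d (inj₁ refl) = inj₁ refl
balanced-+ d (inj₂ refl) = inj₂ refl

balanced-∸ : ∀ {k j d} → d ≤ k → Balanced k j → Balanced (k ∸ d) (j ∸ d)
balanced-∸ d≤k (inj₁ refl) = inj₁ refl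
balanced-∸ d≤k (inj₂ refl) = inj₂ (+-∸-assoc 1 d≤k)

balanced-≤ : ∀ {k j} → Balanced k j → k ≤ j
balanced-≤ (inj₁ refl) = ≤-refl
balanced-≤ (inj₂ refl) = n≤1+n _

-- (x + y)(x + y − 1) ≤ 4xy for x = k + 1, y = j + 1, since (x − y)² ≤ x + y when |x − y| ≤ 1.
balanced-product : ∀ {k j} → Balanced k j → suc (suc (k + j)) * suc (k + j) ≤ 4 * (suc k * suc j)
balanced-product {k} (inj₁ refl) = subst (suc (suc (k + k)) * suc (k + k) ≤_) (expand k) (m≤m+n _ _)
  where
  expand : ∀ k → suc (suc (k + k)) * suc (k + k) + suc (suc (k + k)) ≡ 4 * (suc k * suc k)
  expand = solve-∀
balanced-product {k} (inj₂ refl) =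
  subst (suc (suc (k + suc k)) * suc (k + suc k) ≤_) (expand k) (m≤m+n _ (suc (suc (k + k))))
  where
  expand : ∀ k → suc (suc (k + suc k)) * suc (k + suc k) + suc (suc (k + k)) ≡ 4 * (suc k * suc (suc k))
  expand = solve-∀

central-step : ∀ {k j} → Balanced k j → suc (suc (k + j)) C suc k ≤ 4 * ((k + j) C k)
central-step {k} {j} bal = *-cancelˡ-≤ (suc k * suc j) (begin
    (suc k * suc j) * (suc (suc (k + j)) C suc k)  ≡⟨ double-absorption k j ⟩
    (suc (suc (k + j)) * suc (k + j)) * ((k + j) C k)  ≤⟨ *-monoˡ-≤ ((k + j) C k) (balanced-product bal) ⟩
    (4 * (suc k * suc j)) * ((k + j) C k)          ≡⟨ reassoc (suc k * suc j) ((k + j) C k) ⟩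
    (suc k * suc j) * (4 * ((k + j) C k))          ∎)
  where
  open ≤-Reasoning
  reassoc : ∀ a x → (4 * a) * x ≡ a * (4 * x)
  reassoc = solve-∀

central-shift : ∀ Δ {r s} → Balanced r s → ((r + Δ) + (s + Δ)) C (r + Δ) ≤ 4 ^ Δ * ((r + s) C r)
central-shift zero {r} {s} bal = begin
    ((r + 0) + (s + 0)) C (r + 0)  ≡⟨ cong₂ (λ x y → (x + y) C x) (+-identityʳ r) (+-identityʳ s) ⟩
    (r + s) C r                    ≡⟨ *-identityˡ _ ⟨
    1 * ((r + s) C r)              ∎
  where open ≤-Reasoning
central-shift (suc Δ) {r} {s} bal = begin
    ((r + suc Δ) + (s + suc Δ)) C (r + suc Δ)          ≡⟨ cong₂ (λ x y → (x + y) C x) (+-suc r Δ) (+-suc s Δ) ⟩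
    (suc (r + Δ) + suc (s + Δ)) C suc (r + Δ)          ≡⟨ cong (_C suc (r + Δ)) (cong suc (+-suc (r + Δ) (s + Δ))) ⟩
    suc (suc ((r + Δ) + (s + Δ))) C suc (r + Δ)        ≤⟨ central-step (balanced-+ Δ bal) ⟩
    4 * (((r + Δ) + (s + Δ)) C (r + Δ))                ≤⟨ *-monoʳ-≤ 4 (central-shift Δ bal) ⟩
    4 * (4 ^ Δ * ((r + s) C r))                        ≡⟨ *-assoc 4 (4 ^ Δ) _ ⟨
    4 ^ suc Δ * ((r + s) C r)                          ∎
  where open ≤-Reasoning

central-bound : ∀ {Δ q b} → Δ ≤ q → Balanced q b →
  (q + b) C q ≤ 4 ^ Δ * (((q ∸ Δ) + (b ∸ Δ)) C (q ∸ Δ))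
central-bound {Δ} {q} {b} Δ≤q bal =
  subst₂ (λ x y → (x + y) C x ≤ 4 ^ Δ * (((q ∸ Δ) + (b ∸ Δ)) C (q ∸ Δ)))
    (m∸n+n≡m Δ≤q) (m∸n+n≡m (≤-trans Δ≤q (balanced-≤ bal)))
    (central-shift Δ (balanced-∸ Δ≤q bal))

remove-half : ∀ t q → (t + q * 2) ∸ q ≡ t + q
remove-half t q = trans (cong (_∸ q) (regroup t q)) (m+n∸n≡m (t + q) q)
  where
  regroup : ∀ t q → t + q * 2 ≡ (t + q) + q
  regroup = solve-∀

halves-balanced : ∀ n → Balanced (n / 2) (n ∸ n / 2)
halves-balanced n with n % 2 | m%n<n n 2 | m≡m%n+[m/n]*n n 2
... | zero        | _            | n≡ = inj₁ (trans (cong (_∸ n / 2) n≡) (remove-half 0 (n / 2)))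
... | suc zero    | _            | n≡ = inj₂ (trans (cong (_∸ n / 2) n≡) (remove-half 1 (n / 2)))
... | suc (suc _) | s≤s (s≤s ()) | _

countTrue-punchIn : ∀ {m} (f : Fin (suc m) → Bool) (y : Fin (suc m)) →
  countTrue (λ z → f (punchIn y z)) ≤ countTrue f
countTrue-punchIn f zero = m≤n+m _ _
countTrue-punchIn {suc m} f (suc y) =
  +-monoʳ-≤ (if f zero then 1 else 0) (countTrue-punchIn (λ z → f (suc z)) y)

some-true : ∀ {m} (f : Fin m → Bool) → countTrue (λ y → not (f y)) < m → ∃ λ y → f y ≡ true
some-true {suc m} f few with f zero in f0
... | true  = zero , f0
... | false with some-true (λ z → f (suc z)) (≤-pred few)
...   | y , fy = suc y , fy

maxFin-upper : ∀ {m} (f : Fin m → ℕ) x → f x ≤ maxFin f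
maxFin-upper f zero = m≤m⊔n _ _
maxFin-upper f (suc x) = ≤-trans (maxFin-upper (λ k → f (suc k)) x) (m≤n⊔m _ _)

MissesAtMost : ∀ {a b} → ℕ → BipGraph a b → Set
MissesAtMost Δ G = ∀ x → degree (bipComplement G) (inj₁ x) ≤ Δ

maxDegree-misses : ∀ {a b Δ} (G : BipGraph a b) → maxDegree (bipComplement G) ≡ Δ → MissesAtMost Δ G
maxDegree-misses G refl x =
  ≤-trans (maxFin-upper (λ x → degree (bipComplement G) (inj₁ x)) x) (m≤m⊔n _ _)

neighbour : ∀ {a b Δ} (G : BipGraph a b) → MissesAtMost Δ G → Δ < b → ∀ x → ∃ λ y → G x y ≡ true
neighbour G misses Δ<b x = some-true (G x) (≤-<-trans (misses x) Δ<b)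

restrict : ∀ {a b a′ b′} → BipGraph a′ b′ → (Fin a → Fin a′) → (Fin b → Fin b′) → BipGraph a b
restrict G fA fB x y = G (fA x) (fB y)

restrict-Adj : ∀ {a b a′ b′} (G : BipGraph a′ b′) (fA : Fin a → Fin a′) (fB : Fin b → Fin b′) u v →
  Adj (restrict G fA fB) u v → Adj G (Sum.map fA fB u) (Sum.map fA fB v)
restrict-Adj G fA fB (inj₁ x) (inj₂ y) adj = adj
restrict-Adj G fA fB (inj₂ y) (inj₁ x) adj = adj

Adj-sym : ∀ {a b} (G : BipGraph a b) u v → Adj G u v → Adj G v u
Adj-sym G (inj₁ x) (inj₂ y) adj = adj
Adj-sym G (inj₂ y) (inj₁ x) adj = adj

GDifferent-sym : ∀ {n a b} (G : BipGraph a b) (π σ : Perm n a b) → GDifferent G π σ → GDifferent G σ π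
GDifferent-sym G π σ (i , adj) = i , Adj-sym G _ _ adj

-- A permutation whose first entry is the new element of V′ ≅ 1 + V and whose remaining
-- entries follow π.
prepend : ∀ {V V′ : Set} {n} → (Fin 1 ⊎ V) ↔ V′ → Fin n ↔ V → Fin (suc n) ↔ V′
prepend e π = e ↔-∘ ((↔-refl ⊎-↔ π) ↔-∘ +↔⊎ {1})

extendA : ∀ {a b} → (Fin 1 ⊎ Vertex a b) ↔ Vertex (suc a) b
extendA {a} {b} = mk↔ₛ′ to from to-from from-to
  where
  to : Fin 1 ⊎ Vertex a b → Vertex (suc a) b
  to = [ (λ _ → inj₁ zero) , Sum.map suc id ]
  from : Vertex (suc a) b → Fin 1 ⊎ Vertex a b
  from (inj₁ zero)    = inj₁ zero
  from (inj₁ (suc x)) = inj₂ (inj₁ x)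
  from (inj₂ y)       = inj₂ (inj₂ y)
  to-from : ∀ v → to (from v) ≡ v
  to-from (inj₁ zero)    = refl
  to-from (inj₁ (suc x)) = refl
  to-from (inj₂ y)       = refl
  from-to : ∀ u → from (to u) ≡ u
  from-to (inj₁ zero)     = refl
  from-to (inj₂ (inj₁ x)) = refl
  from-to (inj₂ (inj₂ y)) = refl

extendB : ∀ {a b} → Fin (suc b) → (Fin 1 ⊎ Vertex a b) ↔ Vertex a (suc b)
extendB {a} {b} y = mk↔ₛ′ to from to-from from-to
  where
  to : Fin 1 ⊎ Vertex a b → Vertex a (suc b)
  to = [ (λ _ → inj₂ y) , Sum.map id (punchIn y) ]
  from : Vertex a (suc b) → Fin 1 ⊎ Vertex a b
  from (inj₁ x) = inj₂ (inj₁ x)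
  from (inj₂ z) with y ≟ z
  ... | yes _  = inj₁ zero
  ... | no y≢z = inj₂ (inj₂ (punchOut y≢z))
  to-from : ∀ v → to (from v) ≡ v
  to-from (inj₁ x) = refl
  to-from (inj₂ z) with y ≟ z
  ... | yes y≡z = cong inj₂ y≡z
  ... | no y≢z  = cong inj₂ (punchIn-punchOut y≢z)
  from-to : ∀ u → from (to u) ≡ u
  from-to (inj₁ zero) with y ≟ y
  ... | yes _  = refl
  ... | no y≢y = ⊥-elim (y≢y refl)
  from-to (inj₂ (inj₁ x)) = refl
  from-to (inj₂ (inj₂ z)) with y ≟ punchIn y z
  ... | yes y≡ = ⊥-elim (punchInᵢ≢i y z (sym y≡))
  ... | no y≢  = cong (λ w → inj₂ (inj₂ w)) (punchOut-punchIn y)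

prepend-different : ∀ {n a b a′ b′} (G : BipGraph a′ b′) (fA : Fin a → Fin a′) (fB : Fin b → Fin b′)
  (e : (Fin 1 ⊎ Vertex a b) ↔ Vertex a′ b′) → (∀ v → Inverse.to e (inj₂ v) ≡ Sum.map fA fB v) →
  (π σ : Perm n a b) → GDifferent (restrict G fA fB) π σ → GDifferent G (prepend e π) (prepend e σ)
prepend-different G fA fB e embeds π σ (i , adj) =
  suc i , subst₂ (Adj G) (sym (embeds (Inverse.to π i))) (sym (embeds (Inverse.to σ i)))
                 (restrict-Adj G fA fB (Inverse.to π i) (Inverse.to σ i) adj)

F≥1 : ∀ {a b} (G : BipGraph a b) → FAtLeast {a + b} G 1
F≥1 G = (λ _ → +↔⊎) , λ { zero zero 0≢0 → ⊥-elim (0≢0 refl) }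

concat-families : ∀ {n a b k₁ k₂} (G : BipGraph a b) (f₁ : Fin k₁ → Perm n a b) (f₂ : Fin k₂ → Perm n a b) →
  PairwiseGDifferent G f₁ → PairwiseGDifferent G f₂ → (∀ i j → GDifferent G (f₁ i) (f₂ j)) →
  FAtLeast {n} G (k₁ + k₂)
concat-families {n} {a} {b} {k₁} {k₂} G f₁ f₂ diff₁ diff₂ cross = family , pairwise
  where
  family : Fin (k₁ + k₂) → Perm n a b
  family i = [ f₁ , f₂ ] (splitAt k₁ i)
  split-injective : ∀ {i j} → splitAt k₁ i ≡ splitAt k₁ j → i ≡ j
  split-injective {i} {j} e = begin
      i                         ≡⟨ Inverse.strictlyInverseʳ (+↔⊎ {k₁} {k₂}) i ⟨
      join k₁ k₂ (splitAt k₁ i) ≡⟨ cong (join k₁ k₂) e ⟩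
      join k₁ k₂ (splitAt k₁ j) ≡⟨ Inverse.strictlyInverseʳ (+↔⊎ {k₁} {k₂}) j ⟩
      j                         ∎
    where open ≡-Reasoning
  pairwise : PairwiseGDifferent G family
  pairwise i j i≢j with splitAt k₁ i in ei | splitAt k₁ j in ej
  ... | inj₁ i′ | inj₁ j′ = diff₁ i′ j′ (λ i′≡j′ → i≢j (split-injective (trans ei (trans (cong inj₁ i′≡j′) (sym ej)))))
  ... | inj₂ i′ | inj₂ j′ = diff₂ i′ j′ (λ i′≡j′ → i≢j (split-injective (trans ei (trans (cong inj₂ i′≡j′) (sym ej)))))
  ... | inj₁ i′ | inj₂ j′ = cross i′ j′
  ... | inj₂ i′ | inj₁ j′ = GDifferent-sym G (f₁ j′) (f₂ i′) (cross j′ i′)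

-- Induction: a permutation either starts with the first-side vertex 0, or with a fixed
-- neighbour y of it; the two resulting subfamilies differ at position 0 via the edge {0, y},
-- and their sizes add up by Pascal's rule.
lower-bound : ∀ Δ r s {a b n} (G : BipGraph a b) → a + b ≡ n → r ≤ a → s + Δ ≤ b → MissesAtMost Δ G →
  FAtLeast {n} G ((r + s) C r)
lower-bound Δ zero s G refl _ _ _ = subst (FAtLeast G) (sym (nC0≡1 s)) (F≥1 G)
lower-bound Δ (suc r) zero G refl _ _ _ =
  subst (FAtLeast G) (sym (trans (cong (_C suc r) (+-identityʳ (suc r))) (nCn≡1 (suc r)))) (F≥1 G)
lower-bound Δ (suc r) (suc s) {suc a} {suc b} G refl (s≤s r≤a) s+Δ≤b@(s≤s s+Δ≤b′) misses =
  subst (FAtLeast G) sizes (concat-families G family₀ family-y pairwise₀ pairwise-y cross)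
  where
  y-edge : ∃ λ y → G zero y ≡ true
  y-edge = neighbour G misses (s≤s (≤-trans (m≤n+m Δ s) s+Δ≤b′)) zero
  y : Fin (suc b)
  y = proj₁ y-edge
  misses-without-y : MissesAtMost Δ (restrict G id (punchIn y))
  misses-without-y x = ≤-trans (countTrue-punchIn (λ z → not (G x z)) y) (misses x)
  -- permutations of G − {0} and of G − {y}, to be prefixed by 0 and by y respectively
  without-0 : FAtLeast {a + suc b} (restrict G suc id) ((r + suc s) C r)
  without-0 = lower-bound Δ r (suc s) (restrict G suc id) refl r≤a s+Δ≤b (λ x → misses (suc x))
  without-y : FAtLeast {a + suc b} (restrict G id (punchIn y)) ((suc r + s) C suc r)
  without-y = lower-bound Δ (suc r) s (restrict G id (punchIn y)) (sym (+-suc a b))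
                (s≤s r≤a) s+Δ≤b′ misses-without-y
  family₀ : Fin ((r + suc s) C r) → Perm (suc a + suc b) (suc a) (suc b)
  family₀ i = prepend extendA (proj₁ without-0 i)
  family-y : Fin ((suc r + s) C suc r) → Perm (suc a + suc b) (suc a) (suc b)
  family-y j = prepend (extendB y) (proj₁ without-y j)
  pairwise₀ : PairwiseGDifferent G family₀
  pairwise₀ i j i≢j = prepend-different G suc id extendA (λ _ → refl)
                        (proj₁ without-0 i) (proj₁ without-0 j) (proj₂ without-0 i j i≢j)
  pairwise-y : PairwiseGDifferent G family-y
  pairwise-y i j i≢j = prepend-different G id (punchIn y) (extendB y) (λ _ → refl)
                         (proj₁ without-y i) (proj₁ without-y j) (proj₂ without-y i j i≢j)
  cross : ∀ i j → GDifferent G (family₀ i) (family-y j)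
  cross i j = zero , proj₂ y-edge
  sizes : (r + suc s) C r + (suc r + s) C suc r ≡ (suc r + suc s) C suc r
  sizes = trans (cong (λ m → (r + suc s) C r + m C suc r) (sym (+-suc r s)))
                (sym (pascal (r + suc s) r))

≤-half : ∀ {Δ n} → 2 * Δ ≤ n → Δ ≤ n / 2
≤-half {Δ} {n} 2Δ≤n = begin
  Δ            ≡⟨ m*n/n≡m Δ 2 ⟨
  Δ * 2 / 2    ≤⟨ /-monoˡ-≤ 2 (subst (_≤ n) (*-comm 2 Δ) 2Δ≤n) ⟩
  n / 2        ∎
  where open ≤-Reasoning

-- With q = ⌊n/2⌋ and b = n − q, the main
-- estimate with r = q − Δ and s = b − Δ gives C(n − 2Δ, q − Δ), which `central-bound`
-- compares with C(n, q).
corollary2 : (n Δ : ℕ) → 2 * Δ ≤ n →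
    (G : BipGraph (n / 2) (n ∸ n / 2)) → maxDegree (bipComplement G) ≡ Δ →
    ∃ λ k → (n C (n / 2) ≤ 2 ^ (2 * Δ) * k) × FAtLeast {n} G k
corollary2 n Δ 2Δ≤n G maxDeg =
  (r + s) C r , binomial-bound ,
  lower-bound Δ r s G q+b≡n (m∸n≤m q Δ) (≤-reflexive (m∸n+n≡m Δ≤b)) (maxDegree-misses G maxDeg)
  where
  q b r s : ℕ
  q = n / 2
  b = n ∸ n / 2
  r = q ∸ Δ
  s = b ∸ Δ
  q+b≡n : q + b ≡ n
  q+b≡n = m+[n∸m]≡n (m/n≤m n 2)
  Δ≤q : Δ ≤ q
  Δ≤q = ≤-half 2Δ≤n
  Δ≤b : Δ ≤ b
  Δ≤b = ≤-trans Δ≤q (balanced-≤ (halves-balanced n))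
  binomial-bound : n C q ≤ 2 ^ (2 * Δ) * ((r + s) C r)
  binomial-bound = subst₂ (λ m c → m C q ≤ c * ((r + s) C r)) q+b≡n (^-*-assoc 2 2 Δ)
                     (central-bound Δ≤q (halves-balanced n))
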